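{- Let $(S,\mathit{Tr},\mathrm{source},\mathrm{target},\ell,\smile^{\bullet})$ be a labelled transition system with concurrency, augmented with the set of tasks $\mathcal T=\{T_t\mid t\in\mathit{Tr}^\bullet\}$ where $T_t=\{u\in\mathit{Tr}^\circ\mid t\not\smile^{\bullet}u\}$, and let $\mathit{Rec}\subseteq B\subseteq\mathit{Act}$. Then every path that is strongly $B$-fair or weakly $B$-fair is $B$-just.
   Context: A labelled transition system (LTS) is a tuple $(S,\mathit{Tr},\mathrm{source},\mathrm{target},\ell)$ with $\mathrm{source},\mathrm{target}:\mathit{Tr}\to S$, $\ell:\mathit{Tr}\to\mathit{Lab}$, and subsets $\mathit{Rec}\subseteq\mathit{Act}\subseteq\mathit{Lab}$. Transitions with label outside $\mathit{Act}$ are indicator transitions. $\mathit{Tr}^\circ=\{t\mid\ell(t)\in\mathit{Act}\}$, $\mathit{Tr}^\bullet=\{t\mid\ell(t)\in\mathit{Act}\setminus\mathit{Rec}\}$, $\mathit{Tr}^\bullet_{\neg B}=\{t\in\mathit{Tr}^\bullet\mid\ell(t)\notin B\}$. A path is an alternating sequence $s_0\,t_1\,s_1\,t_2\cdots$ of states and non-indicator transitions, starting with a state, infinite or ending with a state, with $\mathrm{source}(t_i)=s_{i-1}$, $\mathrm{target}(t_i)=s_i$. An LTSC is an LTS with $\smile^{\bullet}\subseteq\mathit{Tr}^\bullet\times\mathit{Tr}$ such that (1) $t\not\smile^{\bullet}t$ for $t\in\mathit{Tr}^\bullet$, and (2) if $t\in\mathit{Tr}^\bullet$ and $\pi$ is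 a path from $\mathrm{source}(t)$ to $s$ with $t\smile^{\bullet}v$ for all transitions $v$ of $\pi$, then some $u\in\mathit{Tr}^\bullet$ has $\mathrm{source}(u)=s$, $\ell(u)=\ell(t)$, $t\not\smile^{\bullet}u$. A path $\pi$ is $B$-just if for each suffix $\pi'$ and each $t\in\mathit{Tr}^\bullet_{\neg B}$ with source the first state of $\pi'$, some $u$ with $t\not\smile^{\bullet}u$ occurs in $\pi'$. For a set $\mathcal T$ of tasks $T\subseteq\mathit{Tr}^\circ$: $T$ is $B$-enabled in state $s$ if some $t\in T$ has $\ell(t)\notin B$ and $\mathrm{source}(t)=s$; $T$ occurs in $\pi$ if $\pi$ contains a transition of $T$; $T$ is relentlessly $B$-enabled on $\pi$ if each suffix of $\pi$ contains a state where $T$ is $B$-enabled; perpetually $B$-enabled on $\pi$ if $B$-enabled in every state of $\pi$. A path $\pi$ is strongly (resp. weakly) $B$-fair if for every suffix $\pi'$ of $\pi$, every task relentlessly (resp. perpetually) $B$-enabled on $\pi'$ occurs in $\pi'$. -}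

module Defs where

open import Data.Nat using (ℕ; zero; suc; _≤_; _<_)
open import Data.Unit using (⊤)
open import Data.Product using (Σ; _×_; ∃; _,_)
open import Relation.Nullary using (¬_)
open import Relation.Binary.PropositionalEquality using (_≡_)

-- Lengths of paths: finite (number of transitions) or infinite.
data Len : Set where
  fin : ℕ → Len
  inf : Len

StIdx : Len → ℕ → Set
StIdx (fin n) i = i ≤ n
StIdx inf     i = ⊤

-- i is the index of a transition (the (i+1)-th, going from state i to state i+1)
TrIdx : Len → ℕ → Set
TrIdx (fin n) i = i < n
TrIdx inf     i = ⊤

record LTS : Set₁ where
  field
    S Tr Lab : Set
    source target : Tr → S
    ℓ : Tr → Lab
    Act Rec : Lab → Set
    Rec⊆Act : ∀ a → Rec a → Act a

  Tr° : Tr → Set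
  Tr° t = Act (ℓ t)

  Tr• : Tr → Set
  Tr• t = Act (ℓ t) × ¬ Rec (ℓ t)

  Tr•¬ : (Lab → Set) → Tr → Set
  Tr•¬ B t = Tr• t × ¬ B (ℓ t)

  -- A path s₀ t₁ s₁ t₂ ⋯ : states st i (i a state index), transitions tr i
  -- (i a transition index) going from st i to st (suc i); all transitions
  -- are non-indicator transitions. Values outside the index range are irrelevant.
  record Path : Set where
    field
      len : Len
      st  : ℕ → S
      tr  : ℕ → Tr
      tr-act    : ∀ i → TrIdx len i → Act (ℓ (tr i))
      tr-source : ∀ i → TrIdx len i → source (tr i) ≡ st i
      tr-target : ∀ i → TrIdx len i → target (tr i) ≡ st (suc i)

  PathFromTo : Path → S → S → Set
  PathFromTo π s s' = Σ ℕ λ n → (Path.len π ≡ fin n) × (Path.st π 0 ≡ s) × (Path.st π n ≡ s')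

record LTSC : Set₁ where
  field
    lts : LTS
  open LTS lts
  field
    _⌣_ : Tr → Tr → Set
    ⌣⊆Tr• : ∀ t u → t ⌣ u → Tr• t
    irrefl : ∀ t → Tr• t → ¬ (t ⌣ t)
    closure : ∀ (t : Tr) → Tr• t → (π : Path) → (s : S) → PathFromTo π (source t) s →
              (∀ i → TrIdx (Path.len π) i → t ⌣ Path.tr π i) →
              Σ Tr λ u → Tr• u × source u ≡ s × ℓ u ≡ ℓ t × ¬ (t ⌣ u)

module _ (L : LTSC) where
  open LTSC L
  open LTS lts

  Task : Tr → Tr → Set
  Task t u = Tr° u × ¬ (t ⌣ u)

  EnabledIn : (Lab → Set) → (Tr → Set) → S → Set
  EnabledIn B T s = Σ Tr λ u → T u × ¬ B (ℓ u) × source u ≡ s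

  module _ (π : Path) where
    open Path π

    -- In the following, k (a state index) designates the suffix π' of π starting at state k.

    OccursFrom : (Tr → Set) → ℕ → Set
    OccursFrom T k = Σ ℕ λ j → k ≤ j × TrIdx len j × T (tr j)

    RelentlesslyFrom : (Lab → Set) → (Tr → Set) → ℕ → Set
    RelentlesslyFrom B T k = ∀ m → k ≤ m → StIdx len m →
      Σ ℕ λ j → m ≤ j × StIdx len j × EnabledIn B T (st j)

    PerpetuallyFrom : (Lab → Set) → (Tr → Set) → ℕ → Set
    PerpetuallyFrom B T k = ∀ j → k ≤ j → StIdx len j → EnabledIn B T (st j)

  StronglyFair : (Lab → Set) → Path → Set
  StronglyFair B π = ∀ k → StIdx (Path.len π) k → ∀ t → Tr• t →
    RelentlesslyFrom π B (Task t) k → OccursFrom π (Task t) k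

  WeaklyFair : (Lab → Set) → Path → Set
  WeaklyFair B π = ∀ k → StIdx (Path.len π) k → ∀ t → Tr• t →
    PerpetuallyFrom π B (Task t) k → OccursFrom π (Task t) k

  Just : (Lab → Set) → Path → Set
  Just B π = ∀ k → StIdx (Path.len π) k → ∀ t → Tr•¬ B t →
    source t ≡ Path.st π k →
    Σ ℕ λ j → k ≤ j × TrIdx (Path.len π) j × ¬ (t ⌣ Path.tr π j)

module Submission where

-- Let t ∈ Tr•_{¬B} start in state k of π. If some later transition of π
-- interferes with t (t ⌣̸ u) we are done. Otherwise t is concurrent with every
-- transition from state k on; then for every later state j, the segment of π from
-- k to j is a path from source(t) all of whose transitions are concurrent with t,
-- so the closure axiom of an LTSC yields u ∈ Tr• at state j with ℓ(u) = ℓ(t) ∉ B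
-- and t ⌣̸ u, i.e. u ∈ T_t. Hence T_t is perpetually B-enabled from k, weak
-- fairness makes T_t occur, and an occurrence of T_t is an interfering transition.

open import Defs
open import Level using (0ℓ)
open import Function using (id)
open import Axiom.ExcludedMiddle using (ExcludedMiddle)
open import Data.Nat using (ℕ; _+_; _∸_; _≤_; _<_)
open import Data.Nat.Properties using (≤-refl; <-≤-trans; +-monoʳ-<; +-identityʳ; +-suc; m≤m+n; m+[n∸m]≡n)
open import Data.Product using (Σ; _×_; _,_; proj₁)
open import Data.Sum using (_⊎_; inj₁; inj₂; [_,_])
open import Data.Unit using (tt)
open import Relation.Nullary using (¬_; yes; no)
open import Relation.Nullary.Decidable using (decidable-stable)
open import Relation.Binary.PropositionalEquality using (_≡_; refl; sym; trans; cong; subst)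

module Segments (𝓛 : LTS) (π : LTS.Path 𝓛) where
  open LTS 𝓛
  open Path π

  trIdx-inside : ∀ k {n i} → i < n → StIdx len (k + n) → TrIdx len (k + i)
  trIdx-inside k i<n k+n∈π with len
  ... | fin m = <-≤-trans (+-monoʳ-< k i<n) k+n∈π
  ... | inf   = tt

  segment : ∀ k n → StIdx len (k + n) → Path
  segment k n k+n∈π = record
    { len       = fin n
    ; st        = λ i → st (k + i)
    ; tr        = λ i → tr (k + i)
    ; tr-act    = λ i i<n → tr-act (k + i) (trIdx-inside k i<n k+n∈π)
    ; tr-source = λ i i<n → tr-source (k + i) (trIdx-inside k i<n k+n∈π)
    ; tr-target = λ i i<n → trans (tr-target (k + i) (trIdx-inside k i<n k+n∈π))
                                  (cong st (sym (+-suc k i)))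
    }

  segment-from-to : ∀ k n (k+n∈π : StIdx len (k + n)) →
                    PathFromTo (segment k n k+n∈π) (st k) (st (k + n))
  segment-from-to k n _ = n , refl , cong st (+-identityʳ k) , refl

module _ (L : LTSC) where
  open LTSC L
  open LTS lts

  perpetually⇒relentlessly : ∀ (π : Path) B T k →
    PerpetuallyFrom L π B T k → RelentlesslyFrom L π B T k
  perpetually⇒relentlessly π B T k perpetual m k≤m m∈π = m , ≤-refl , m∈π , perpetual m k≤m m∈π

  strong⇒weak : ∀ B (π : Path) → StronglyFair L B π → WeaklyFair L B π
  strong⇒weak B π strong k k∈π t t• perpetual =
    strong k k∈π t t• (perpetually⇒relentlessly π B (Task L t) k perpetual)

  module _ (B : Lab → Set) (π : Path) where
    open Path π
    open Segments lts π

    InterruptedFrom : Tr → ℕ → Set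
    InterruptedFrom t k = Σ ℕ λ j → k ≤ j × TrIdx len j × ¬ (t ⌣ tr j)

    ConcurrentFrom : Tr → ℕ → Set
    ConcurrentFrom t k = ∀ j → k ≤ j → TrIdx len j → t ⌣ tr j

    -- (3) If t ∈ Tr•_{¬B} starts at state k and is concurrent with all later
    -- transitions, the closure axiom keeps T_t B-enabled at every later state.
    concurrent⇒perpetually-enabled : ∀ t k → Tr•¬ B t → source t ≡ st k →
      ConcurrentFrom t k → PerpetuallyFrom L π B (Task L t) k
    concurrent⇒perpetually-enabled t k (t• , t∉B) src concurrent j k≤j j∈π =
      subst (λ i → EnabledIn L B (Task L t) (st i)) (m+[n∸m]≡n k≤j) (enabled-at (j ∸ k) (reindex j∈π))
      where
      reindex : StIdx len j → StIdx len (k + (j ∸ k))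
      reindex = subst (StIdx len) (sym (m+[n∸m]≡n k≤j))
      -- Closure applied to the segment from k to k + n gives the enabling transition u.
      enabled-at : ∀ n → StIdx len (k + n) → EnabledIn L B (Task L t) (st (k + n))
      enabled-at n k+n∈π with closure t t• (segment k n k+n∈π) (st (k + n))
          (subst (λ s → PathFromTo (segment k n k+n∈π) s (st (k + n))) (sym src)
                 (segment-from-to k n k+n∈π))
          (λ i i<n → concurrent (k + i) (m≤m+n k i) (trIdx-inside k i<n k+n∈π))
      ... | u , u• , source-u , ℓu≡ℓt , t⌣̸u =
        u , (proj₁ u• , t⌣̸u) , (λ u∈B → t∉B (subst B ℓu≡ℓt u∈B)) , source-u

    interrupted-or-concurrent : ExcludedMiddle 0ℓ → ∀ t k →
      InterruptedFrom t k ⊎ ConcurrentFrom t k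
    interrupted-or-concurrent lem t k with lem {InterruptedFrom t k}
    ... | yes interrupted = inj₁ interrupted
    ... | no uninterrupted = inj₂ λ j k≤j j∈π →
      decidable-stable lem λ t⌣̸tr → uninterrupted (j , k≤j , j∈π , t⌣̸tr)

    -- (5) Weakly fair paths are just: in the concurrent case the task T_t is
    -- perpetually enabled, so it occurs, and its occurrence interrupts t.
    weak⇒just : ExcludedMiddle 0ℓ → WeaklyFair L B π → Just L B π
    weak⇒just lem weak k k∈π t t∈Tr•¬B src with interrupted-or-concurrent lem t k
    ... | inj₁ interrupted = interrupted
    ... | inj₂ concurrent
        with weak k k∈π t (proj₁ t∈Tr•¬B)
                  (concurrent⇒perpetually-enabled t k t∈Tr•¬B src concurrent)
    ...   | j , k≤j , j∈π , (_ , t⌣̸tr) = j , k≤j , j∈π , t⌣̸tr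

-- The hypotheses Rec ⊆ B ⊆ Act are part of the setting but not needed by the argument.
proposition1 : ExcludedMiddle 0ℓ → (L : LTSC) → (B : LTS.Lab (LTSC.lts L) → Set) →
    (∀ a → LTS.Rec (LTSC.lts L) a → B a) → (∀ a → B a → LTS.Act (LTSC.lts L) a) →
    (π : LTS.Path (LTSC.lts L)) →
    (StronglyFair L B π ⊎ WeaklyFair L B π) → Just L B π
proposition1 lem L B _ _ π fair = weak⇒just L B π lem ([ strong⇒weak L B π , id ] fair)
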